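{- Let $q$ be even, $q>2$, let $\Sigma_\infty$ be a hyperplane of $\mathrm{PG}(4,q)$, and let $\mathcal{C}$ be a set of $q^2$ affine points ($\mathcal{C}$-points) together with a set of planes ($\mathcal{C}$-planes) satisfying (A1)–(A4). Then no three $\mathcal{C}$-points are collinear.
   Context: Affine points are points of $\mathrm{PG}(4,q)\setminus\Sigma_\infty$. Conditions: (A1) each $\mathcal{C}$-plane meets $\mathcal{C}$ in a $q$-arc (q points, no three collinear); (A2) any two distinct $\mathcal{C}$-points lie in a unique $\mathcal{C}$-plane; (A3) every affine point not in $\mathcal{C}$ lies on exactly one $\mathcal{C}$-plane; (A4) every plane meeting $\mathcal{C}$ in at least three points either meets $\mathcal{C}$ in exactly four points or is a $\mathcal{C}$-plane. -}

module Defs where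

open import Level using (0ℓ)
open import Data.Nat using (ℕ; _^_)
open import Data.Fin using (Fin)
open import Data.Product using (Σ; ∃; ∃-syntax; _×_; _,_)
open import Data.Sum using (_⊎_)
open import Relation.Binary.PropositionalEquality using (_≡_; _≢_)
open import Relation.Nullary using (¬_)
open import Function.Bundles using (_↔_)
open import Function.Definitions using (Injective)
open import Algebra.Structures using (IsCommutativeRing)

record FiniteField (q : ℕ) : Set₁ where
  field
    F    : Set
    _+_  : F → F → F
    _*_  : F → F → F
    -_   : F → F
    0#   : F
    1#   : F
    isCommutativeRing : IsCommutativeRing _≡_ _+_ _*_ -_ 0# 1#
    0≢1  : 0# ≢ 1#
    inv  : ∀ x → x ≢ 0# → ∃[ y ] (x * y ≡ 1#)
    card : F ↔ Fin q

-- Projective geometry PG(4,q) over a finite field: points are nonzero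
-- vectors of F^5, considered up to nonzero scalar multiples.
module PG4 {q : ℕ} (𝔽 : FiniteField q) where
  open FiniteField 𝔽

  V : Set
  V = Fin 5 → F

  zeroV : V
  zeroV _ = 0#

  _≈V_ : V → V → Set
  x ≈V y = ∀ i → x i ≡ y i

  IsPoint : V → Set
  IsPoint x = ¬ (x ≈V zeroV)

  SamePoint : V → V → Set
  SamePoint x y = ∃[ c ] (c ≢ 0# × (∀ i → y i ≡ c * x i))

  lin3 : F → V → F → V → F → V → V
  lin3 a x b y c z i = ((a * x i) + (b * y i)) + (c * z i)

  -- three vectors linearly dependent; for three distinct projective
  -- points this means exactly that they are collinear
  Collinear : V → V → V → Set
  Collinear x y z =
    ∃[ a ] ∃[ b ] ∃[ c ] (¬ (a ≡ 0# × b ≡ 0# × c ≡ 0#) × lin3 a x b y c z ≈V zeroV)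

  record Plane : Set where
    constructor plane
    field
      u v w : V
      indep : ¬ Collinear u v w

  _∈P_ : V → Plane → Set
  x ∈P plane u v w _ = ∃[ a ] ∃[ b ] ∃[ c ] (x ≈V lin3 a u b v c w)

  SamePlane : Plane → Plane → Set
  SamePlane π σ = ∀ x → (x ∈P π → x ∈P σ) × (x ∈P σ → x ∈P π)

  -- a hyperplane of PG(4,q), given by a nonzero linear form h
  record Hyperplane : Set where
    constructor hyperplane
    field
      h       : V
      nonzero : IsPoint h

  dot : V → V → F
  dot h x = ((((h Data.Fin.zero * x Data.Fin.zero)
    + (h (Data.Fin.suc Data.Fin.zero) * x (Data.Fin.suc Data.Fin.zero)))
    + (h (Data.Fin.suc (Data.Fin.suc Data.Fin.zero)) * x (Data.Fin.suc (Data.Fin.suc Data.Fin.zero))))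
    + (h (Data.Fin.suc (Data.Fin.suc (Data.Fin.suc Data.Fin.zero))) * x (Data.Fin.suc (Data.Fin.suc (Data.Fin.suc Data.Fin.zero)))))
    + (h (Data.Fin.suc (Data.Fin.suc (Data.Fin.suc (Data.Fin.suc Data.Fin.zero))))
        * x (Data.Fin.suc (Data.Fin.suc (Data.Fin.suc (Data.Fin.suc Data.Fin.zero)))))

  Affine : Hyperplane → V → Set
  Affine (hyperplane h _) x = IsPoint x × dot h x ≢ 0#

  -- A set 𝒞 of q² affine points (listed without repetition as projective
  -- points) together with a set of planes (predicate CPl), relative to Σ∞.
  record Config (Σ∞ : Hyperplane) : Set₁ where
    field
      pt       : Fin (q ^ 2) → V
      affine   : ∀ i → Affine Σ∞ (pt i)
      distinct : ∀ i j → SamePoint (pt i) (pt j) → i ≡ j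
      CPl      : Plane → Set

    IsCPlane : Plane → Set
    IsCPlane π = ∃[ σ ] (CPl σ × SamePlane π σ)

    MeetsIn : ℕ → Plane → Set
    MeetsIn k π = Σ (Fin k → Fin (q ^ 2)) λ f →
      Injective _≡_ _≡_ f × (∀ a → pt (f a) ∈P π) × (∀ i → pt i ∈P π → ∃[ a ] (f a ≡ i))

    Distinct3 : Fin (q ^ 2) → Fin (q ^ 2) → Fin (q ^ 2) → Set
    Distinct3 i j k = i ≢ j × i ≢ k × j ≢ k

    A1 : Set
    A1 = ∀ π → CPl π → MeetsIn q π ×
           (∀ i j k → Distinct3 i j k → pt i ∈P π → pt j ∈P π → pt k ∈P π →
              ¬ Collinear (pt i) (pt j) (pt k))

    A2 : Set
    A2 = ∀ i j → i ≢ j → ∃[ π ] (CPl π × pt i ∈P π × pt j ∈P π ×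
           (∀ σ → CPl σ → pt i ∈P σ → pt j ∈P σ → SamePlane σ π))

    A3 : Set
    A3 = ∀ x → Affine Σ∞ x → (∀ i → ¬ SamePoint x (pt i)) →
           ∃[ π ] (CPl π × x ∈P π × (∀ σ → CPl σ → x ∈P σ → SamePlane σ π))

    A4 : Set
    A4 = ∀ π → (∃[ i ] ∃[ j ] ∃[ k ] (Distinct3 i j k × pt i ∈P π × pt j ∈P π × pt k ∈P π)) →
           MeetsIn 4 π ⊎ IsCPlane π

-- Three collinear points have one of them in the span of the other two. By (A2) those
-- two lie on a 𝒞-plane, which therefore contains all three, and this contradicts the
-- arc property (A1).
module Submission where

open import Defs
open import Data.Nat using (ℕ; _<_)
open import Data.Nat.Divisibility using (_∣_)
open import Data.Product using (_×_; _,_; proj₂; ∃-syntax)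
open import Data.Sum using (_⊎_; inj₁; inj₂)
open import Data.Empty using (⊥-elim)
import Data.Fin.Properties as Fin
open import Algebra.Bundles using (CommutativeRing)
import Algebra.Properties.Group as GroupProperties
import Algebra.Properties.AbelianGroup as AbelianGroupProperties
import Algebra.Properties.Ring as RingProperties
import Algebra.Properties.CommutativeSemigroup as CommutativeSemigroupProperties
open import Function.Properties.Inverse using (↔⇒↣)
open import Relation.Nullary using (¬_; yes; no)
open import Relation.Nullary.Decidable using (via-injection)
open import Relation.Binary.Definitions using (DecidableEquality)
open import Relation.Binary.PropositionalEquality

module PlaneIncidence {q : ℕ} (𝔽 : FiniteField q) where
  open FiniteField 𝔽
  open PG4 𝔽

  private
    commutativeRing : CommutativeRing _ _
    commutativeRing = record { isCommutativeRing = isCommutativeRing }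

  open CommutativeRing commutativeRing
    using ( ring; +-group; +-abelianGroup; +-commutativeSemigroup; *-commutativeSemigroup
          ; *-assoc; *-identityˡ; distribˡ; distribʳ)
  open GroupProperties +-group using (inverseʳ-unique)
  open AbelianGroupProperties +-abelianGroup using (⁻¹-∙-comm)
  open RingProperties ring using (-‿distribˡ-*)
  open CommutativeSemigroupProperties +-commutativeSemigroup using (interchange; xy∙z≈xz∙y; xy∙z≈zx∙y)
  open CommutativeSemigroupProperties *-commutativeSemigroup using (xy∙z≈y∙xz)
  open ≡-Reasoning

  _≟_ : DecidableEquality F
  _≟_ = via-injection (↔⇒↣ card) Fin._≟_

  -‿distrib-linear : ∀ a b x y → - ((a * x) + (b * y)) ≡ ((- a) * x) + ((- b) * y)
  -‿distrib-linear a b x y = begin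
    - ((a * x) + (b * y))         ≡⟨ sym (⁻¹-∙-comm (a * x) (b * y)) ⟩
    (- (a * x)) + (- (b * y))     ≡⟨ cong₂ _+_ (-‿distribˡ-* a x) (-‿distribˡ-* b y) ⟩
    ((- a) * x) + ((- b) * y)     ∎

  solve-for-third : ∀ {a b c d x y z} → c * d ≡ 1# → ((a * x) + (b * y)) + (c * z) ≡ 0# →
                    z ≡ ((d * (- a)) * x) + ((d * (- b)) * y)
  solve-for-third {a} {b} {c} {d} {x} {y} {z} cd≡1 relation = begin
    z                                         ≡⟨ sym (*-identityˡ z) ⟩
    1# * z                                    ≡⟨ cong (_* z) (sym cd≡1) ⟩
    (c * d) * z                               ≡⟨ xy∙z≈y∙xz c d z ⟩
    d * (c * z)                               ≡⟨ cong (d *_) (inverseʳ-unique _ _ relation) ⟩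
    d * (- ((a * x) + (b * y)))               ≡⟨ cong (d *_) (-‿distrib-linear a b x y) ⟩
    d * (((- a) * x) + ((- b) * y))           ≡⟨ distribˡ d _ _ ⟩
    (d * ((- a) * x)) + (d * ((- b) * y))     ≡⟨ sym (cong₂ _+_ (*-assoc d (- a) x) (*-assoc d (- b) y)) ⟩
    ((d * (- a)) * x) + ((d * (- b)) * y)     ∎

  scale-lin3 : ∀ e a b c (u v w : V) i → e * lin3 a u b v c w i ≡ lin3 (e * a) u (e * b) v (e * c) w i
  scale-lin3 e a b c u v w i = begin
    e * (((a * u i) + (b * v i)) + (c * w i))               ≡⟨ distribˡ e _ _ ⟩
    (e * ((a * u i) + (b * v i))) + (e * (c * w i))         ≡⟨ cong (_+ (e * (c * w i))) (distribˡ e _ _) ⟩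
    ((e * (a * u i)) + (e * (b * v i))) + (e * (c * w i))   ≡⟨ sym (cong₂ _+_ (cong₂ _+_ (*-assoc e a (u i))
                                                                 (*-assoc e b (v i))) (*-assoc e c (w i))) ⟩
    lin3 (e * a) u (e * b) v (e * c) w i                     ∎

  add-lin3 : ∀ a b c a′ b′ c′ (u v w : V) i →
             lin3 a u b v c w i + lin3 a′ u b′ v c′ w i ≡ lin3 (a + a′) u (b + b′) v (c + c′) w i
  add-lin3 a b c a′ b′ c′ u v w i = begin
    (((a * u i) + (b * v i)) + (c * w i)) + (((a′ * u i) + (b′ * v i)) + (c′ * w i))
      ≡⟨ interchange _ _ _ _ ⟩
    (((a * u i) + (b * v i)) + ((a′ * u i) + (b′ * v i))) + ((c * w i) + (c′ * w i))
      ≡⟨ cong₂ _+_ (interchange _ _ _ _) (sym (distribʳ (w i) c c′)) ⟩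
    (((a * u i) + (a′ * u i)) + ((b * v i) + (b′ * v i))) + ((c + c′) * w i)
      ≡⟨ cong (_+ ((c + c′) * w i)) (sym (cong₂ _+_ (distribʳ (u i) a a′) (distribʳ (v i) b b′))) ⟩
    lin3 (a + a′) u (b + b′) v (c + c′) w i
      ∎

  ∈P-resp-≈V : ∀ π {x y} → x ≈V y → y ∈P π → x ∈P π
  ∈P-resp-≈V π x≈y (a , b , c , y≈) = a , b , c , λ i → trans (x≈y i) (y≈ i)

  ∈P-linear : ∀ π {x y} e f → x ∈P π → y ∈P π → (λ i → (e * x i) + (f * y i)) ∈P π
  ∈P-linear (plane u v w _) {x} {y} e f (a , b , c , x≈) (a′ , b′ , c′ , y≈) =
    (e * a) + (f * a′) , (e * b) + (f * b′) , (e * c) + (f * c′) , λ i → begin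
      (e * x i) + (f * y i)
        ≡⟨ cong₂ (λ s t → (e * s) + (f * t)) (x≈ i) (y≈ i) ⟩
      (e * lin3 a u b v c w i) + (f * lin3 a′ u b′ v c′ w i)
        ≡⟨ cong₂ _+_ (scale-lin3 e a b c u v w i) (scale-lin3 f a′ b′ c′ u v w i) ⟩
      lin3 (e * a) u (e * b) v (e * c) w i + lin3 (f * a′) u (f * b′) v (f * c′) w i
        ≡⟨ add-lin3 _ _ _ _ _ _ u v w i ⟩
      lin3 ((e * a) + (f * a′)) u ((e * b) + (f * b′)) v ((e * c) + (f * c′)) w i
        ∎

  OnPlanesThrough : V → V → V → Set
  OnPlanesThrough x y z = ∀ π → x ∈P π → y ∈P π → z ∈P π

  dependent⇒onPlanesThrough : ∀ {a b c x y z} → lin3 a x b y c z ≈V zeroV → c ≢ 0# →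
                              OnPlanesThrough x y z
  dependent⇒onPlanesThrough {a} {b} {c} dependent c≢0 π x∈π y∈π with inv c c≢0
  ... | d , cd≡1 = ∈P-resp-≈V π (λ i → solve-for-third cd≡1 (dependent i))
                     (∈P-linear π (d * (- a)) (d * (- b)) x∈π y∈π)

  collinear⇒onPlanesThroughOtherTwo : ∀ {x y z} → Collinear x y z →
    OnPlanesThrough x y z ⊎ OnPlanesThrough x z y ⊎ OnPlanesThrough y z x
  collinear⇒onPlanesThroughOtherTwo {x} {y} {z} (a , b , c , nontrivial , dependent)
    with c ≟ 0# | b ≟ 0# | a ≟ 0#
  ... | no c≢0 | _      | _      = inj₁ (dependent⇒onPlanesThrough dependent c≢0)
  ... | yes _  | no b≢0 | _      = inj₂ (inj₁ (dependent⇒onPlanesThrough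
        (λ i → trans (xy∙z≈xz∙y (a * x i) (c * z i) (b * y i)) (dependent i)) b≢0))
  ... | yes _  | yes _  | no a≢0 = inj₂ (inj₂ (dependent⇒onPlanesThrough
        (λ i → trans (xy∙z≈zx∙y (b * y i) (c * z i) (a * x i)) (dependent i)) a≢0))
  ... | yes c≡0 | yes b≡0 | yes a≡0 = ⊥-elim (nontrivial (a≡0 , b≡0 , c≡0))

module _ {q : ℕ} {𝔽 : FiniteField q} {Σ∞ : PG4.Hyperplane 𝔽} (𝒞 : PG4.Config 𝔽 Σ∞) where
  open PG4 𝔽
  open Config 𝒞
  open PlaneIncidence 𝔽 using (OnPlanesThrough; collinear⇒onPlanesThroughOtherTwo)

  cPlane-through : A2 → ∀ {i j k} → i ≢ j → OnPlanesThrough (pt i) (pt j) (pt k) →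
                   ∃[ π ] (CPl π × pt i ∈P π × pt j ∈P π × pt k ∈P π)
  cPlane-through a2 {i} {j} i≢j k-on with a2 i j i≢j
  ... | π , π∈𝒞 , i∈π , j∈π , _ = π , π∈𝒞 , i∈π , j∈π , k-on π i∈π j∈π

  collinear⇒onCPlane : A2 → ∀ {i j k} → Distinct3 i j k → Collinear (pt i) (pt j) (pt k) →
                       ∃[ π ] (CPl π × pt i ∈P π × pt j ∈P π × pt k ∈P π)
  collinear⇒onCPlane a2 (i≢j , i≢k , j≢k) collinear with collinear⇒onPlanesThroughOtherTwo collinear
  ... | inj₁ k-on = cPlane-through a2 i≢j k-on
  ... | inj₂ (inj₁ j-on) with cPlane-through a2 i≢k j-on
  ...   | π , π∈𝒞 , i∈π , k∈π , j∈π = π , π∈𝒞 , i∈π , j∈π , k∈π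
  collinear⇒onCPlane a2 (_ , _ , j≢k) _ | inj₂ (inj₂ i-on) with cPlane-through a2 j≢k i-on
  ...   | π , π∈𝒞 , j∈π , k∈π , i∈π = π , π∈𝒞 , i∈π , j∈π , k∈π

lemma4p2 : (q : ℕ) → 2 ∣ q → 2 < q → (𝔽 : FiniteField q) →
    let open PG4 𝔽 in (Σ∞ : Hyperplane) → (𝒞 : Config Σ∞) →
    let open Config 𝒞 in A1 → A2 → A3 → A4 →
    ∀ i j k → Distinct3 i j k → ¬ Collinear (pt i) (pt j) (pt k)
lemma4p2 q _ _ 𝔽 Σ∞ 𝒞 a1 a2 _ _ i j k distinct collinear
  with collinear⇒onCPlane 𝒞 a2 distinct collinear
... | π , π∈𝒞 , i∈π , j∈π , k∈π = proj₂ (a1 π π∈𝒞) i j k distinct i∈π j∈π k∈π collinear
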